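{- Let $G$ and $H$ be finite simple graphs without isolated vertices. Let $g=(A_0,A_1,A_2)$ be a $\gamma_{tR}(G)$-function chosen with $|A_2|$ maximum among all $\gamma_{tR}(G)$-functions, and let $h=(B_0,B_1,B_2)$ be a $\gamma_{tR}(H)$-function chosen with $|B_2|$ maximum among all $\gamma_{tR}(H)$-functions. Then $$\max\{\rho(H)\gamma_{tR}(G),\ \rho(G)\gamma_{tR}(H)\}\le \gamma_{tR}(G\times H)\le \gamma_{tR}(G)\gamma_{tR}(H)-2|A_2||B_2|.$$
   Context: All graphs are finite and simple. For a graph $G$, a function $f:V(G)\to\{0,1,2\}$ is written $f=(V_0,V_1,V_2)$ with $V_i=\{v: f(v)=i\}$; its weight is $\omega(f)=\sum_{v}f(v)$. $f$ is a total Roman dominating function if every vertex in $V_0$ has a neighbor in $V_2$ and the subgraph induced by $V_1\cup V_2$ has no isolated vertices. $\gamma_{tR}(G)$ is the minimum weight of a total Roman dominating function on $G$; a $\gamma_{tR}(G)$-function is a total Roman dominating function of weight $\gamma_{tR}(G)$. A packing of $G$ is a set $D$ of vertices with $N[u]\cap N[v]=\emptyset$ for all distinct $u,v\in D$ ($N[\cdot]$ the closed neighborhood); $\rho(G)$ is the maximum size of a packing. The direct product $G\times H$ has vertex set $V(G)\times V(H)$, with $(g,h)(g',h')$ an edge iff $gg'\in E(G)$ and $hh'\in E(H)$. -}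

module Defs where

open import Data.Nat using (ℕ; _≤_)
open import Data.Bool using (Bool; true; false; _∧_)
open import Data.Fin using (Fin; toℕ; quotient; remainder)
open import Data.Fin.Subset using (Subset; _∈_; ∣_∣)
open import Data.Nat.ListAction using (sum)
open import Data.List using (List; map; filter; length; allFin)
open import Data.Product using (Σ; ∃; _×_; _,_)
open import Data.Sum using (_⊎_)
open import Relation.Nullary using (¬_)
open import Relation.Binary.PropositionalEquality using (_≡_; _≢_; refl; cong₂)
open import Data.Nat using (_≟_)
open import Function using (_∘_)

record Graph : Set where
  field
    n      : ℕ
    adj    : Fin n → Fin n → Bool
    sym    : ∀ u v → adj u v ≡ adj v u
    irrefl : ∀ v → adj v v ≡ false

open Graph public

Vertex : Graph → Set
Vertex G = Fin (n G)

Adj : (G : Graph) → Vertex G → Vertex G → Set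
Adj G u v = adj G u v ≡ true

NoIsolated : Graph → Set
NoIsolated G = ∀ v → ∃ λ u → Adj G v u

-- Direct product G × H on vertex set Fin (n G * n H);
-- vertex x corresponds to the pair (quotient x , remainder x).
_⊗_ : Graph → Graph → Graph
G ⊗ H = record
  { n      = n G Data.Nat.* n H
  ; adj    = λ x y → adj G (quotient (n H) x) (quotient (n H) y)
                   ∧ adj H (remainder {n G} (n H) x) (remainder {n G} (n H) y)
  ; sym    = λ x y → cong₂ _∧_ (sym G (quotient (n H) x) (quotient (n H) y))
                               (sym H (remainder {n G} (n H) x) (remainder {n G} (n H) y))
  ; irrefl = λ x → lemma (adj G (quotient (n H) x) (quotient (n H) x))
                         (irrefl G (quotient (n H) x)) _
  }
  where
  lemma : ∀ a → a ≡ false → ∀ b → a ∧ b ≡ false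
  lemma .false refl b = refl

Labelling : Graph → Set
Labelling G = Vertex G → Fin 3

weight : (G : Graph) → Labelling G → ℕ
weight G f = sum (map (toℕ ∘ f) (allFin (n G)))

size₂ : (G : Graph) → Labelling G → ℕ
size₂ G f = length (filter (λ v → toℕ (f v) ≟ 2) (allFin (n G)))

IsTRDF : (G : Graph) → Labelling G → Set
IsTRDF G f =
  (∀ v → toℕ (f v) ≡ 0 → ∃ λ u → Adj G v u × toℕ (f u) ≡ 2)
  × (∀ v → toℕ (f v) ≢ 0 → ∃ λ u → Adj G v u × toℕ (f u) ≢ 0)

IsγtR : Graph → ℕ → Set
IsγtR G k = (∃ λ f → IsTRDF G f × weight G f ≡ k)
          × (∀ f → IsTRDF G f → k ≤ weight G f)

IsγtRFunction : (G : Graph) → Labelling G → Set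
IsγtRFunction G f = IsTRDF G f × (∀ f' → IsTRDF G f' → weight G f ≤ weight G f')

IsMaxV₂γtRFunction : (G : Graph) → Labelling G → Set
IsMaxV₂γtRFunction G f =
  IsγtRFunction G f × (∀ f' → IsγtRFunction G f' → size₂ G f' ≤ size₂ G f)

InClosedNbhd : (G : Graph) → Vertex G → Vertex G → Set
InClosedNbhd G u w = (w ≡ u) ⊎ Adj G u w

IsPacking : (G : Graph) → Subset (n G) → Set
IsPacking G D = ∀ u v → u ∈ D → v ∈ D → u ≢ v →
  ¬ (∃ λ w → InClosedNbhd G u w × InClosedNbhd G v w)

Isρ : Graph → ℕ → Set
Isρ G k = (∃ λ D → IsPacking G D × ∣ D ∣ ≡ k)
        × (∀ D → IsPacking G D → ∣ D ∣ ≤ k)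

-- For TRDFs g, h the labelling (g ⊙ h)(x,y) = 0 if g x or h y
-- is 0, 1 if both are 1, and 2 otherwise is a TRDF of G × H, and pointwise
-- g x · h y = (g ⊙ h)(x,y) + 2 [g x = 2][h y = 2]; summing gives
-- ω(g ⊙ h) + 2 |A₂| |B₂| = ω(g) ω(h).
--
-- For a TRDF F of G × H and a vertex y of H, the labelling
-- x ↦ min (2, ∑_{y' ∈ N[y]} F x y') is a TRDF of G, so its weight is at
-- least γtR(G).  Summing over the vertices y of a packing D of H, whose
-- closed neighbourhoods are disjoint, gives |D| γtR(G) ≤ ω(F).  The other
-- lower bound follows by exchanging the roles of G and H.
module Submission where

open import Defs hiding (sym)
open import Data.Nat using (ℕ; _≤_; _+_; _*_; _⊔_; zero; suc; z≤n; s≤s; _≟_)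
open import Data.Nat.Properties
  using (+-*-semiring; +-identityʳ; *-identityˡ; +-assoc; ≤-reflexive; ≤-trans; ≤-antisym;
         m≤m+n; m≤n+m; +-mono-≤; +-monoˡ-≤; *-monoˡ-≤; *-monoʳ-≤; n≤0⇒n≡0; ⊔-lub;
         module ≤-Reasoning)
import Data.Nat.ListAction as List
open import Algebra.Properties.Semiring.Sum +-*-semiring
  using (sum-syntax; sum-cong-≗; ∑-distrib-+; ∑-comm; *-distribˡ-sum; *-distribʳ-sum)
open import Data.Fin as Fin using (Fin; toℕ; combine; quotient; remainder; _↑ˡ_; _↑ʳ_)
open import Data.Fin.Properties as Finₚ using (remQuot-combine; combine-remQuot)
open import Data.Fin.Patterns using (0F; 1F; 2F)
open import Data.Fin.Subset using (Subset; ∣_∣)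
open import Data.Bool using (Bool; true; false; _∧_; _∨_)
open import Data.List using ([]; _∷_; map; filter; length; allFin; tabulate)
open import Data.List.Properties using (map-tabulate)
open import Data.Vec as Vec using (lookup)
open import Data.Vec.Properties using (lookup⇒[]=)
open import Data.Product using (_×_; _,_; proj₁; proj₂; ∃; ∃₂)
open import Data.Sum using (_⊎_; inj₁; inj₂)
open import Data.Empty using (⊥-elim)
open import Relation.Nullary using (does; yes; no)
open import Relation.Binary.PropositionalEquality
open import Function using (_∘_)

2≢0 : 2 ≢ 0
2≢0 ()

ind : Bool → ℕ
ind true  = 1
ind false = 0

ind-∧-* : ∀ a b m → ind a * (ind b * m) ≡ ind (a ∧ b) * m
ind-∧-* true  b m = +-identityʳ (ind b * m)
ind-∧-* false b m = refl

∧-true : ∀ {a b} → a ∧ b ≡ true → (a ≡ true) × (b ≡ true)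
∧-true {true} {true} refl = refl , refl

∑-mono : ∀ {n} {f g : Fin n → ℕ} → (∀ i → f i ≤ g i) → ∑[ i < n ] f i ≤ ∑[ i < n ] g i
∑-mono {zero}  f≤g = z≤n
∑-mono {suc n} f≤g = +-mono-≤ (f≤g Fin.zero) (∑-mono (f≤g ∘ Fin.suc))

term≤∑ : ∀ {n} (f : Fin n → ℕ) i → f i ≤ ∑[ j < n ] f j
term≤∑ f Fin.zero    = m≤m+n _ _
term≤∑ f (Fin.suc i) = ≤-trans (term≤∑ (f ∘ Fin.suc) i) (m≤n+m _ _)

∑-zero : ∀ {n} {f : Fin n → ℕ} → (∀ i → f i ≡ 0) → ∑[ i < n ] f i ≡ 0
∑-zero {zero}  f≡0 = refl
∑-zero {suc n} f≡0 = cong₂ _+_ (f≡0 Fin.zero) (∑-zero (f≡0 ∘ Fin.suc))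

∑-product : ∀ {m n} (f : Fin m → ℕ) (g : Fin n → ℕ) →
  (∑[ i < m ] f i) * (∑[ j < n ] g j) ≡ ∑[ i < m ] ∑[ j < n ] (f i * g j)
∑-product {m} {n} f g = trans (*-distribʳ-sum (∑[ j < n ] g j) f)
  (sum-cong-≗ (λ i → *-distribˡ-sum (f i) g))

∑-split : ∀ a {b} (f : Fin (a + b) → ℕ) →
  ∑[ i < a + b ] f i ≡ ∑[ i < a ] f (i ↑ˡ b) + ∑[ j < b ] f (a ↑ʳ j)
∑-split zero    f = refl
∑-split (suc a) f = trans (cong (f Fin.zero +_) (∑-split a (f ∘ Fin.suc)))
  (sym (+-assoc (f Fin.zero) _ _))

∑-combine : ∀ m {k} (f : Fin (m * k) → ℕ) →
  ∑[ z < m * k ] f z ≡ ∑[ i < m ] ∑[ j < k ] f (combine i j)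
∑-combine zero    f = refl
∑-combine (suc m) {k} f = trans (∑-split k f)
  (cong (∑[ j < k ] f (j ↑ˡ (m * k)) +_) (∑-combine m (λ z → f (k ↑ʳ z))))

∑-ind-unique : ∀ {n} (p : Fin n → Bool) →
  (∀ i j → p i ≡ true → p j ≡ true → i ≡ j) → ∑[ i < n ] ind (p i) ≤ 1
∑-ind-unique {zero}  p unique = z≤n
∑-ind-unique {suc n} p unique with p Fin.zero in p₀
... | false = ∑-ind-unique (p ∘ Fin.suc) (λ i j pi pj → Finₚ.suc-injective (unique _ _ pi pj))
... | true  = ≤-reflexive (cong suc (∑-zero rest-false))
  where
  rest-false : ∀ i → ind (p (Fin.suc i)) ≡ 0
  rest-false i with p (Fin.suc i) in pᵢ
  ... | false = refl
  ... | true  = ⊥-elim (Finₚ.0≢1+n (unique Fin.zero (Fin.suc i) p₀ pᵢ))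

∑-disjoint : ∀ {m n} (p : Fin m → Fin n → Bool) →
  (∀ j i i' → p i j ≡ true → p i' j ≡ true → i ≡ i') → (a : Fin n → ℕ) →
  ∑[ i < m ] ∑[ j < n ] (ind (p i j) * a j) ≤ ∑[ j < n ] a j
∑-disjoint {m} {n} p unique a = begin
  ∑[ i < m ] ∑[ j < n ] (ind (p i j) * a j)
    ≡⟨ ∑-comm (λ i j → ind (p i j) * a j) ⟩
  ∑[ j < n ] ∑[ i < m ] (ind (p i j) * a j)
    ≡⟨ sum-cong-≗ (λ j → sym (*-distribʳ-sum (a j) (λ i → ind (p i j)))) ⟩
  ∑[ j < n ] ((∑[ i < m ] ind (p i j)) * a j)
    ≤⟨ ∑-mono (λ j → *-monoˡ-≤ (a j) (∑-ind-unique (λ i → p i j) (unique j))) ⟩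
  ∑[ j < n ] (1 * a j)
    ≡⟨ sum-cong-≗ (λ j → *-identityˡ (a j)) ⟩
  ∑[ j < n ] a j ∎
  where open ≤-Reasoning

listSum-allFin : ∀ n (f : Fin n → ℕ) → List.sum (map f (allFin n)) ≡ ∑[ i < n ] f i
listSum-allFin n f = trans (cong List.sum (map-tabulate (λ i → i) f)) (sum-tabulate n)
  where
  sum-tabulate : ∀ k {g : Fin k → ℕ} → List.sum (tabulate g) ≡ ∑[ i < k ] g i
  sum-tabulate zero    = refl
  sum-tabulate (suc k) {g} = cong (g Fin.zero +_) (sum-tabulate k)

weight-∑ : ∀ G (f : Labelling G) → weight G f ≡ ∑[ v < n G ] toℕ (f v)
weight-∑ G f = listSum-allFin (n G) (toℕ ∘ f)

is2 : Fin 3 → ℕ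
is2 a = ind (does (toℕ a ≟ 2))

size₂-∑ : ∀ G (f : Labelling G) → size₂ G f ≡ ∑[ v < n G ] is2 (f v)
size₂-∑ G f = trans (length-filter (allFin (n G))) (listSum-allFin (n G) (is2 ∘ f))
  where
  length-filter : ∀ xs → length (filter (λ v → toℕ (f v) ≟ 2) xs) ≡ List.sum (map (is2 ∘ f) xs)
  length-filter []       = refl
  length-filter (x ∷ xs) with does (toℕ (f x) ≟ 2)
  ... | false = length-filter xs
  ... | true  = cong suc (length-filter xs)

∣∣-∑ : ∀ {k} (D : Subset k) → ∣ D ∣ ≡ ∑[ y < k ] ind (lookup D y)
∣∣-∑ Vec.[]           = refl
∣∣-∑ (true  Vec.∷ D) = cong suc (∣∣-∑ D)
∣∣-∑ (false Vec.∷ D) = ∣∣-∑ D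

γtR≡weight : ∀ G {γ} {g : Labelling G} → IsγtR G γ → IsγtRFunction G g → γ ≡ weight G g
γtR≡weight G ((f , f-trdf , ωf≡γ) , γ-min) (g-trdf , g-min) =
  ≤-antisym (γ-min _ g-trdf) (subst (weight G _ ≤_) ωf≡γ (g-min f f-trdf))

NeighbourWith : ∀ G → Labelling G → (ℕ → Set) → Vertex G → Set
NeighbourWith G g P x = ∃ λ x' → Adj G x x' × P (toℕ (g x'))

positive-neighbour : ∀ G {g : Labelling G} → IsTRDF G g → ∀ x → NeighbourWith G g (_≢ 0) x
positive-neighbour G {g} (dominated , not-isolated) x with toℕ (g x) ≟ 0
... | no  gx≢0 = not-isolated x gx≢0
... | yes gx≡0 with dominated x gx≡0
...   | x' , x~x' , gx'≡2 = x' , x~x' , λ gx'≡0 → 2≢0 (trans (sym gx'≡2) gx'≡0)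

Labelling² : Graph → Graph → Set
Labelling² G H = Vertex G → Vertex H → Fin 3

NeighbourWith² : ∀ G H → Labelling² G H → (ℕ → Set) → Vertex G → Vertex H → Set
NeighbourWith² G H F P x y = ∃₂ λ x' y' → Adj G x x' × Adj H y y' × P (toℕ (F x' y'))

IsTRDF² : (G H : Graph) → Labelling² G H → Set
IsTRDF² G H F =
  (∀ x y → toℕ (F x y) ≡ 0 → NeighbourWith² G H F (_≡ 2) x y)
  × (∀ x y → toℕ (F x y) ≢ 0 → NeighbourWith² G H F (_≢ 0) x y)

weight² : (G H : Graph) → Labelling² G H → ℕ
weight² G H F = ∑[ x < n G ] ∑[ y < n H ] toℕ (F x y)

IsTRDF²-swap : ∀ G H {F : Labelling² G H} → IsTRDF² G H F → IsTRDF² H G (λ y x → F x y)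
IsTRDF²-swap G H {F} (dominated , not-isolated) =
  (λ y x Fxy≡0 → swap (_≡ 2) (dominated x y Fxy≡0)) ,
  (λ y x Fxy≢0 → swap (_≢ 0) (not-isolated x y Fxy≢0))
  where
  swap : ∀ P {x y} → NeighbourWith² G H F P x y → NeighbourWith² H G (λ b a → F a b) P y x
  swap P (x' , y' , x~x' , y~y' , p) = y' , x' , y~y' , x~x' , p

module Coordinates (G H : Graph) where

  pair : Vertex G → Vertex H → Vertex (G ⊗ H)
  pair = combine

  fst : Vertex (G ⊗ H) → Vertex G
  fst = quotient (n H)

  snd : Vertex (G ⊗ H) → Vertex H
  snd = remainder {n G} (n H)

  fst-pair : ∀ x y → fst (pair x y) ≡ x
  fst-pair x y = cong proj₁ (remQuot-combine x y)

  snd-pair : ∀ x y → snd (pair x y) ≡ y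
  snd-pair x y = cong proj₂ (remQuot-combine x y)

  pair-fst-snd : ∀ z → pair (fst z) (snd z) ≡ z
  pair-fst-snd = combine-remQuot {n G} (n H)

  curry⊗ : Labelling (G ⊗ H) → Labelling² G H
  curry⊗ f x y = f (pair x y)

  uncurry⊗ : Labelling² G H → Labelling (G ⊗ H)
  uncurry⊗ F z = F (fst z) (snd z)

  curry-uncurry : ∀ F x y → curry⊗ (uncurry⊗ F) x y ≡ F x y
  curry-uncurry F x y = cong₂ F (fst-pair x y) (snd-pair x y)

  adj-⊗ : ∀ {x y x' y'} → Adj G x x' → Adj H y y' → Adj (G ⊗ H) (pair x y) (pair x' y')
  adj-⊗ {x} {y} {x'} {y'} x~x' y~y' = subst₂ (λ a b → a ∧ b ≡ true)
    (sym (cong₂ (adj G) (fst-pair x y) (fst-pair x' y')))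
    (sym (cong₂ (adj H) (snd-pair x y) (snd-pair x' y')))
    (cong₂ _∧_ x~x' y~y')

  adj-⊗⁻ : ∀ {x y} z → Adj (G ⊗ H) (pair x y) z → Adj G x (fst z) × Adj H y (snd z)
  adj-⊗⁻ {x} {y} z xy~z = ∧-true
    (subst₂ (λ a b → adj G a (fst z) ∧ adj H b (snd z) ≡ true) (fst-pair x y) (snd-pair x y) xy~z)

  weight-⊗ : ∀ f → weight (G ⊗ H) f ≡ weight² G H (curry⊗ f)
  weight-⊗ f = trans (weight-∑ (G ⊗ H) f) (∑-combine (n G) (toℕ ∘ f))

  weight-uncurry : ∀ F → weight (G ⊗ H) (uncurry⊗ F) ≡ weight² G H F
  weight-uncurry F = trans (weight-⊗ (uncurry⊗ F))
    (sum-cong-≗ (λ x → sum-cong-≗ (λ y → cong toℕ (curry-uncurry F x y))))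

  curry-isTRDF : ∀ {f} → IsTRDF (G ⊗ H) f → IsTRDF² G H (curry⊗ f)
  curry-isTRDF {f} (dominated , not-isolated) =
    (λ x y → from-neighbour (_≡ 2) x y ∘ dominated (pair x y)) ,
    (λ x y → from-neighbour (_≢ 0) x y ∘ not-isolated (pair x y))
    where
    from-neighbour : ∀ P x y → NeighbourWith (G ⊗ H) f P (pair x y) →
                     NeighbourWith² G H (curry⊗ f) P x y
    from-neighbour P x y (z , xy~z , Pz) with adj-⊗⁻ z xy~z
    ... | x~x' , y~y' = fst z , snd z , x~x' , y~y' ,
      subst (P ∘ toℕ ∘ f) (sym (pair-fst-snd z)) Pz

  uncurry-isTRDF : ∀ {F} → IsTRDF² G H F → IsTRDF (G ⊗ H) (uncurry⊗ F)
  uncurry-isTRDF {F} (dominated , not-isolated) =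
    (λ z → to-neighbour (_≡ 2) z ∘ dominated _ _) ,
    (λ z → to-neighbour (_≢ 0) z ∘ not-isolated _ _)
    where
    to-neighbour : ∀ P z → NeighbourWith² G H F P (fst z) (snd z) →
                   NeighbourWith (G ⊗ H) (uncurry⊗ F) P z
    to-neighbour P z (x' , y' , x~x' , y~y' , Px'y') =
      pair x' y' ,
      subst (λ w → Adj (G ⊗ H) w (pair x' y')) (pair-fst-snd z) (adj-⊗ x~x' y~y') ,
      subst (P ∘ toℕ) (sym (curry-uncurry F x' y')) Px'y'

_⊙_ : Fin 3 → Fin 3 → Fin 3
0F ⊙ b  = 0F
1F ⊙ 0F = 0F
1F ⊙ 1F = 1F
1F ⊙ 2F = 2F
2F ⊙ 0F = 0F
2F ⊙ 1F = 2F
2F ⊙ 2F = 2F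

⊙-defect : ∀ a b → toℕ (a ⊙ b) + 2 * (is2 a * is2 b) ≡ toℕ a * toℕ b
⊙-defect 0F b  = refl
⊙-defect 1F 0F = refl
⊙-defect 1F 1F = refl
⊙-defect 1F 2F = refl
⊙-defect 2F 0F = refl
⊙-defect 2F 1F = refl
⊙-defect 2F 2F = refl

⊙-zero : ∀ a b → toℕ (a ⊙ b) ≡ 0 → (toℕ a ≡ 0) ⊎ (toℕ b ≡ 0)
⊙-zero 0F b  _ = inj₁ refl
⊙-zero 1F 0F _ = inj₂ refl
⊙-zero 2F 0F _ = inj₂ refl
⊙-zero 1F 1F ()
⊙-zero 1F 2F ()
⊙-zero 2F 1F ()
⊙-zero 2F 2F ()

⊙-positive : ∀ a b → toℕ a ≢ 0 → toℕ b ≢ 0 → toℕ (a ⊙ b) ≢ 0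
⊙-positive a b a≢0 b≢0 ab≡0 with ⊙-zero a b ab≡0
... | inj₁ a≡0 = a≢0 a≡0
... | inj₂ b≡0 = b≢0 b≡0

⊙-twoˡ : ∀ a b → toℕ a ≡ 2 → toℕ b ≢ 0 → toℕ (a ⊙ b) ≡ 2
⊙-twoˡ 2F 0F _ b≢0 = ⊥-elim (b≢0 refl)
⊙-twoˡ 2F 1F _ _   = refl
⊙-twoˡ 2F 2F _ _   = refl

⊙-twoʳ : ∀ a b → toℕ a ≢ 0 → toℕ b ≡ 2 → toℕ (a ⊙ b) ≡ 2
⊙-twoʳ 0F 2F a≢0 _ = ⊥-elim (a≢0 refl)
⊙-twoʳ 1F 2F _ _   = refl
⊙-twoʳ 2F 2F _ _   = refl

product : ∀ G H → Labelling G → Labelling H → Labelling² G H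
product G H g h x y = g x ⊙ h y

product-isTRDF : ∀ G H {g h} → IsTRDF G g → IsTRDF H h → IsTRDF² G H (product G H g h)
product-isTRDF G H {g} {h} g-trdf h-trdf = dominated , not-isolated
  where
  dominated : ∀ x y → toℕ (g x ⊙ h y) ≡ 0 → NeighbourWith² G H (product G H g h) (_≡ 2) x y
  dominated x y gh≡0 with ⊙-zero (g x) (h y) gh≡0
  ... | inj₁ gx≡0 with proj₁ g-trdf x gx≡0 | positive-neighbour H h-trdf y
  ...   | x' , x~x' , gx'≡2 | y' , y~y' , hy'≢0 =
    x' , y' , x~x' , y~y' , ⊙-twoˡ (g x') (h y') gx'≡2 hy'≢0
  dominated x y gh≡0 | inj₂ hy≡0 with positive-neighbour G g-trdf x | proj₁ h-trdf y hy≡0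
  ...   | x' , x~x' , gx'≢0 | y' , y~y' , hy'≡2 =
    x' , y' , x~x' , y~y' , ⊙-twoʳ (g x') (h y') gx'≢0 hy'≡2
  not-isolated : ∀ x y → toℕ (g x ⊙ h y) ≢ 0 → NeighbourWith² G H (product G H g h) (_≢ 0) x y
  not-isolated x y _ with positive-neighbour G g-trdf x | positive-neighbour H h-trdf y
  ... | x' , x~x' , gx'≢0 | y' , y~y' , hy'≢0 =
    x' , y' , x~x' , y~y' , ⊙-positive (g x') (h y') gx'≢0 hy'≢0

weight-product : ∀ G H (g : Labelling G) (h : Labelling H) →
  weight² G H (product G H g h) + 2 * (size₂ G g * size₂ H h) ≡ weight G g * weight H h
weight-product G H g h = begin
  weight² G H gh + 2 * (size₂ G g * size₂ H h)
    ≡⟨ cong (λ s → weight² G H gh + 2 * s)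
         (trans (cong₂ _*_ (size₂-∑ G g) (size₂-∑ H h)) (∑-product (is2 ∘ g) (is2 ∘ h))) ⟩
  weight² G H gh + 2 * (∑[ x < n G ] ∑[ y < n H ] twos x y)
    ≡⟨ cong (weight² G H gh +_)
         (trans (*-distribˡ-sum 2 (λ x → ∑[ y < n H ] twos x y))
                (sum-cong-≗ (λ x → *-distribˡ-sum 2 (twos x)))) ⟩
  weight² G H gh + ∑[ x < n G ] ∑[ y < n H ] (2 * twos x y)
    ≡⟨ sym (∑-distrib-+ (λ x → ∑[ y < n H ] label x y) (λ x → ∑[ y < n H ] (2 * twos x y))) ⟩
  ∑[ x < n G ] (∑[ y < n H ] label x y + ∑[ y < n H ] (2 * twos x y))
    ≡⟨ sum-cong-≗ (λ x → sym (∑-distrib-+ (label x) (λ y → 2 * twos x y))) ⟩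
  ∑[ x < n G ] ∑[ y < n H ] (label x y + 2 * twos x y)
    ≡⟨ sum-cong-≗ (λ x → sum-cong-≗ (λ y → ⊙-defect (g x) (h y))) ⟩
  ∑[ x < n G ] ∑[ y < n H ] (toℕ (g x) * toℕ (h y))
    ≡⟨ sym (∑-product (toℕ ∘ g) (toℕ ∘ h)) ⟩
  (∑[ x < n G ] toℕ (g x)) * (∑[ y < n H ] toℕ (h y))
    ≡⟨ sym (cong₂ _*_ (weight-∑ G g) (weight-∑ H h)) ⟩
  weight G g * weight H h ∎
  where
  open ≡-Reasoning
  gh : Labelling² G H
  gh = product G H g h
  label : Vertex G → Vertex H → ℕ
  label x y = toℕ (gh x y)
  twos : Vertex G → Vertex H → ℕ
  twos x y = is2 (g x) * is2 (h y)

upper-bound : ∀ G H {γGH} → IsγtR (G ⊗ H) γGH →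
  ∀ {g h} → IsTRDF G g → IsTRDF H h →
  γGH + 2 * (size₂ G g * size₂ H h) ≤ weight G g * weight H h
upper-bound G H {γGH} (_ , γGH-min) {g} {h} g-trdf h-trdf = begin
  γGH + 2 * (size₂ G g * size₂ H h)
    ≤⟨ +-monoˡ-≤ _ (γGH-min _ (uncurry-isTRDF (product-isTRDF G H g-trdf h-trdf))) ⟩
  weight (G ⊗ H) (uncurry⊗ (product G H g h)) + 2 * (size₂ G g * size₂ H h)
    ≡⟨ cong (_+ 2 * (size₂ G g * size₂ H h)) (weight-uncurry (product G H g h)) ⟩
  weight² G H (product G H g h) + 2 * (size₂ G g * size₂ H h)
    ≡⟨ weight-product G H g h ⟩
  weight G g * weight H h ∎
  where
  open ≤-Reasoning
  open Coordinates G H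

closed : ∀ H → Vertex H → Vertex H → Bool
closed H y w = does (w Fin.≟ y) ∨ adj H y w

closed-complete : ∀ H {y w} → InClosedNbhd H y w → closed H y w ≡ true
closed-complete H {y} (inj₁ refl) with y Fin.≟ y
... | yes _   = refl
... | no y≢y = ⊥-elim (y≢y refl)
closed-complete H {y} {w} (inj₂ y~w) with does (w Fin.≟ y)
... | true  = refl
... | false = y~w

closed-sound : ∀ H {y w} → closed H y w ≡ true → InClosedNbhd H y w
closed-sound H {y} {w} c with w Fin.≟ y
... | yes w≡y = inj₁ w≡y
... | no _    = inj₂ c

packing-disjoint : ∀ H {D} → IsPacking H D →
  ∀ w y y' → lookup D y ∧ closed H y w ≡ true → lookup D y' ∧ closed H y' w ≡ true → y ≡ y'
packing-disjoint H {D} packing w y y' in-y in-y' with y Fin.≟ y'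
... | yes y≡y' = y≡y'
... | no  y≢y' with ∧-true in-y | ∧-true in-y'
...   | y∈D , wy | y'∈D , wy' =
  ⊥-elim (packing y y' (lookup⇒[]= y D y∈D) (lookup⇒[]= y' D y'∈D) y≢y'
           (w , closed-sound H wy , closed-sound H wy'))

cap : ℕ → Fin 3
cap zero          = 0F
cap (suc zero)    = 1F
cap (suc (suc _)) = 2F

cap-≤ : ∀ s → toℕ (cap s) ≤ s
cap-≤ zero          = z≤n
cap-≤ (suc zero)    = s≤s z≤n
cap-≤ (suc (suc s)) = s≤s (s≤s z≤n)

cap-zero : ∀ s → toℕ (cap s) ≡ 0 → s ≡ 0
cap-zero zero          _ = refl
cap-zero (suc zero)    ()
cap-zero (suc (suc s)) ()

cap-two : ∀ s → 2 ≤ s → toℕ (cap s) ≡ 2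
cap-two (suc (suc s)) _         = refl
cap-two (suc zero)    (s≤s ())

cap-positive : ∀ s → s ≢ 0 → toℕ (cap s) ≢ 0
cap-positive s s≢0 = s≢0 ∘ cap-zero s

module Projection (G H : Graph) (F : Labelling² G H) (F-trdf : IsTRDF² G H F) where

  nbhdSum : Vertex H → Vertex G → ℕ
  nbhdSum y x = ∑[ w < n H ] (ind (closed H y w) * toℕ (F x w))

  label≤nbhdSum : ∀ x {y w} → InClosedNbhd H y w → toℕ (F x w) ≤ nbhdSum y x
  label≤nbhdSum x {y} {w} w∈N[y] = begin
    toℕ (F x w)
      ≡⟨ sym (+-identityʳ _) ⟩
    1 * toℕ (F x w)
      ≡⟨ cong (λ b → ind b * toℕ (F x w)) (sym (closed-complete H w∈N[y])) ⟩
    ind (closed H y w) * toℕ (F x w)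
      ≤⟨ term≤∑ (λ w' → ind (closed H y w') * toℕ (F x w')) w ⟩
    nbhdSum y x ∎
    where open ≤-Reasoning

  projection : Vertex H → Labelling G
  projection y x = cap (nbhdSum y x)

  -- If F x y = 0, some neighbour (x' , y') has label 2, and then g_y x' = 2.
  projection-two : ∀ x y → toℕ (F x y) ≡ 0 → NeighbourWith G (projection y) (_≡ 2) x
  projection-two x y Fxy≡0 with proj₁ F-trdf x y Fxy≡0
  ... | x' , y' , x~x' , y~y' , Fx'y'≡2 =
    x' , x~x' , cap-two _ (subst (_≤ nbhdSum y x') Fx'y'≡2 (label≤nbhdSum x' (inj₂ y~y')))

  -- g_y is a TRDF of G: F x y ≤ ∑_{w ∈ N[y]} F x w transfers both conditions.
  projection-isTRDF : ∀ y → IsTRDF G (projection y)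
  projection-isTRDF y = dominated , not-isolated
    where
    Fxy≡0 : ∀ x → toℕ (projection y x) ≡ 0 → toℕ (F x y) ≡ 0
    Fxy≡0 x gx≡0 =
      n≤0⇒n≡0 (subst (toℕ (F x y) ≤_) (cap-zero _ gx≡0) (label≤nbhdSum x (inj₁ refl)))
    dominated : ∀ x → toℕ (projection y x) ≡ 0 → NeighbourWith G (projection y) (_≡ 2) x
    dominated x gx≡0 = projection-two x y (Fxy≡0 x gx≡0)
    not-isolated : ∀ x → toℕ (projection y x) ≢ 0 → NeighbourWith G (projection y) (_≢ 0) x
    not-isolated x _ with toℕ (F x y) ≟ 0
    ... | yes Fxy≡0' with projection-two x y Fxy≡0'
    ...   | x' , x~x' , gx'≡2 = x' , x~x' , λ gx'≡0 → 2≢0 (trans (sym gx'≡2) gx'≡0)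
    not-isolated x _ | no Fxy≢0 with proj₂ F-trdf x y Fxy≢0
    ...   | x' , y' , x~x' , y~y' , Fx'y'≢0 =
      x' , x~x' , cap-positive _ (λ s≡0 → Fx'y'≢0
        (n≤0⇒n≡0 (subst (toℕ (F x' y') ≤_) s≡0 (label≤nbhdSum x' (inj₂ y~y')))))

  γtR≤nbhdSums : ∀ {γ} → IsγtR G γ → ∀ y → γ ≤ ∑[ x < n G ] nbhdSum y x
  γtR≤nbhdSums {γ} (_ , γ-min) y = begin
    γ                                             ≤⟨ γ-min _ (projection-isTRDF y) ⟩
    weight G (projection y)                       ≡⟨ weight-∑ G (projection y) ⟩
    ∑[ x < n G ] toℕ (projection y x)             ≤⟨ ∑-mono (λ x → cap-≤ (nbhdSum y x)) ⟩
    ∑[ x < n G ] nbhdSum y x                      ∎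
    where open ≤-Reasoning

  packing-nbhdSums : ∀ {D} → IsPacking H D → ∀ x →
    ∑[ y < n H ] (ind (lookup D y) * nbhdSum y x) ≤ ∑[ w < n H ] toℕ (F x w)
  packing-nbhdSums {D} packing x = begin
    ∑[ y < n H ] (ind (lookup D y) * nbhdSum y x)
      ≡⟨ sum-cong-≗ (λ y → trans
           (*-distribˡ-sum (ind (lookup D y)) (λ w → ind (closed H y w) * toℕ (F x w)))
           (sum-cong-≗ (λ w → ind-∧-* (lookup D y) (closed H y w) (toℕ (F x w))))) ⟩
    ∑[ y < n H ] ∑[ w < n H ] (ind (lookup D y ∧ closed H y w) * toℕ (F x w))
      ≤⟨ ∑-disjoint (λ y w → lookup D y ∧ closed H y w) (packing-disjoint H packing)
                    (toℕ ∘ F x) ⟩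
    ∑[ w < n H ] toℕ (F x w) ∎
    where open ≤-Reasoning

  packing-lower-bound : ∀ {γ D} → IsγtR G γ → IsPacking H D → ∣ D ∣ * γ ≤ weight² G H F
  packing-lower-bound {γ} {D} γ-is packing = begin
    ∣ D ∣ * γ
      ≡⟨ trans (cong (_* γ) (∣∣-∑ D)) (*-distribʳ-sum γ (ind ∘ lookup D)) ⟩
    ∑[ y < n H ] (ind (lookup D y) * γ)
      ≤⟨ ∑-mono (λ y → *-monoʳ-≤ (ind (lookup D y)) (γtR≤nbhdSums γ-is y)) ⟩
    ∑[ y < n H ] (ind (lookup D y) * ∑[ x < n G ] nbhdSum y x)
      ≡⟨ sum-cong-≗ (λ y → *-distribˡ-sum (ind (lookup D y)) (nbhdSum y)) ⟩
    ∑[ y < n H ] ∑[ x < n G ] (ind (lookup D y) * nbhdSum y x)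
      ≡⟨ ∑-comm (λ y x → ind (lookup D y) * nbhdSum y x) ⟩
    ∑[ x < n G ] ∑[ y < n H ] (ind (lookup D y) * nbhdSum y x)
      ≤⟨ ∑-mono (packing-nbhdSums packing) ⟩
    weight² G H F ∎
    where open ≤-Reasoning

open Projection using (packing-lower-bound)

theorem1 : (G H : Graph) → NoIsolated G → NoIsolated H →
    (γG γH γGH ρG ρH : ℕ) →
    IsγtR G γG → IsγtR H γH → IsγtR (G ⊗ H) γGH →
    Isρ G ρG → Isρ H ρH →
    (g : Labelling G) → IsMaxV₂γtRFunction G g →
    (h : Labelling H) → IsMaxV₂γtRFunction H h →
    ((ρH * γG) ⊔ (ρG * γH) ≤ γGH)
      × (γGH + 2 * (size₂ G g * size₂ H h) ≤ γG * γH)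
theorem1 G H _ _ γG γH γGH ρG ρH γG-is γH-is γGH-is@((f , f-trdf , ωf≡γGH) , _)
         ((DG , DG-packing , ∣DG∣≡ρG) , _) ((DH , DH-packing , ∣DH∣≡ρH) , _)
         g (g-γ , _) h (h-γ , _) =
  ⊔-lub lower-H lower-G , upper
  where
  open Coordinates G H
  F : Labelling² G H
  F = curry⊗ f
  Fᵀ : Labelling² H G
  Fᵀ y x = F x y
  ωF≡γGH : weight² G H F ≡ γGH
  ωF≡γGH = trans (sym (weight-⊗ f)) ωf≡γGH
  ωFᵀ≡γGH : weight² H G Fᵀ ≡ γGH
  ωFᵀ≡γGH = trans (∑-comm (λ y x → toℕ (Fᵀ y x))) ωF≡γGH
  lower-H : ρH * γG ≤ γGH
  lower-H = subst₂ _≤_ (cong (_* γG) ∣DH∣≡ρH) ωF≡γGH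
    (packing-lower-bound G H F (curry-isTRDF f-trdf) γG-is DH-packing)
  lower-G : ρG * γH ≤ γGH
  lower-G = subst₂ _≤_ (cong (_* γH) ∣DG∣≡ρG) ωFᵀ≡γGH
    (packing-lower-bound H G Fᵀ (IsTRDF²-swap G H (curry-isTRDF f-trdf)) γH-is DG-packing)
  upper : γGH + 2 * (size₂ G g * size₂ H h) ≤ γG * γH
  upper = subst₂ (λ a b → γGH + 2 * (size₂ G g * size₂ H h) ≤ a * b)
    (sym (γtR≡weight G γG-is g-γ)) (sym (γtR≡weight H γH-is h-γ))
    (upper-bound G H γGH-is (proj₁ g-γ) (proj₁ h-γ))
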